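{- Let $G$ be a simple graph of order $n$ and let $k$ be an integer with $2\le k\le n-1$. Then \[\max_{v\in V(G)}\Big\{\beta\big(F_{k-1}(G-v)\big)+\beta\big(F_k(G-N[v])\big)\Big\}\ \le\ \beta(F_k(G))\ \le\ \frac1k\sum_{v\in V(G)}\beta\big(F_{k-1}(G-v)\big).\]
   Context: For a simple finite graph $H$ and a positive integer $k$, $F_k(H)$ is the graph whose vertices are all $k$-element subsets of $V(H)$, two such subsets being adjacent iff their symmetric difference is an edge of $H$ (if $k>|V(H)|$ this graph has no vertices and its independence number is $0$). $\beta$ denotes the independence number. $G-v$ is $G$ with vertex $v$ deleted, and $G-N[v]$ is $G$ with $v$ and all its neighbours deleted. -}

module Defs where

open import Data.Bool using (Bool; true; false; _∧_; not; _xor_)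
import Data.Bool as Bool
open import Data.Nat using (ℕ; zero; suc; _⊔_)
import Data.Nat as ℕ
open import Data.Fin using (Fin)
open import Data.Fin.Subset using (Subset; ⁅_⁆; _∪_; ∁; ⊤; _-_; ∣_∣; inside; outside)
open import Data.Fin.Subset.Properties using (_⊆?_)
open import Data.List using (List; []; _∷_; [_]; map; _++_; filter; length; foldr; allFin)
open import Data.Bool.ListAction using (any; all)
open import Data.Vec using (Vec; []; _∷_; tabulate; zipWith)
open import Data.Vec.Properties using (≡-dec)
open import Relation.Binary.PropositionalEquality using (_≡_)
open import Relation.Nullary using (Dec)
open import Relation.Nullary.Decidable using (⌊_⌋; _×-dec_)

record Graph (n : ℕ) : Set where
  field
    adj    : Fin n → Fin n → Bool
    sym    : ∀ u v → adj u v ≡ adj v u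
    irrefl : ∀ v → adj v v ≡ false

open Graph public

-- Induced subgraphs G[S] are represented by their vertex set S ⊆ V(G).
--   G        is  G[⊤]
--   G - v    is  G[⊤ - v]
--   G - N[v] is  G[∁ N[v]]

nbhd : ∀ {n} → Graph n → Fin n → Subset n
nbhd G v = tabulate (adj G v)

closedNbhd : ∀ {n} → Graph n → Fin n → Subset n
closedNbhd G v = ⁅ v ⁆ ∪ nbhd G v

allSubsets : (n : ℕ) → List (Subset n)
allSubsets zero    = [ [] ]
allSubsets (suc n) = map (outside ∷_) (allSubsets n) ++ map (inside ∷_) (allSubsets n)

_≟ˢ_ : ∀ {n} (A B : Subset n) → Dec (A ≡ B)
_≟ˢ_ = ≡-dec Bool._≟_

_Δ_ : ∀ {n} → Subset n → Subset n → Subset n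
A Δ B = zipWith _xor_ A B

tokenVertices : ∀ {n} → Subset n → ℕ → List (Subset n)
tokenVertices {n} S k = filter (λ A → (A ⊆? S) ×-dec (∣ A ∣ ℕ.≟ k)) (allSubsets n)

-- adjacency in F_k(G[S]): A Δ B = {u , v} for some edge uv of G
-- (uv is then automatically an edge of G[S], since A , B ⊆ S)
tokenAdj : ∀ {n} → Graph n → Subset n → Subset n → Bool
tokenAdj {n} G A B =
  any (λ u → any (λ v → adj G u v ∧ ⌊ (A Δ B) ≟ˢ (⁅ u ⁆ ∪ ⁅ v ⁆) ⌋) (allFin n)) (allFin n)

independent : ∀ {n} → Graph n → List (Subset n) → Bool
independent G []       = true
independent G (A ∷ As) = all (λ B → not (tokenAdj G A B)) As ∧ independent G As

sublists : ∀ {a} {X : Set a} → List X → List (List X)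
sublists []       = [ [] ]
sublists (x ∷ xs) = sublists xs ++ map (x ∷_) (sublists xs)

maximum : List ℕ → ℕ
maximum = foldr _⊔_ 0

-- β(F_k(G[S])): the maximum size of an independent set of F_k(G[S])
-- (0 if F_k(G[S]) has no vertices)
βF : ∀ {n} → Graph n → (S : Subset n) → (k : ℕ) → ℕ
βF G S k = maximum (map length (filter (λ L → independent G L Bool.≟ true) (sublists (tokenVertices S k))))

sumV : ∀ {n} → (Fin n → ℕ) → ℕ
sumV {n} f = foldr (λ v acc → f v ℕ.+ acc) 0 (allFin n)

-- Lower bound: if I is independent in F_{k-1}(G - v) and J in F_k(G - N[v]), then
-- {A ∪ {v} : A ∈ I} ∪ J is independent in F_k(G). Adding v to both sets preserves
-- symmetric differences, hence adjacency; and A ∪ {v} is never adjacent to B ∈ J,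
-- because a token slide from A ∪ {v} to B must move the token on v (v ∉ B) to a
-- neighbour of v, while B avoids N[v].
-- Upper bound: if W is a maximum independent set of F_k(G), then for each v the members
-- of W containing v, with v removed, form an independent set of F_{k-1}(G - v) of the same
-- size. Summing these sizes over v counts every member of W exactly k times.

module Submission where

open import Defs
open import Data.Nat using (ℕ; _≤_; _+_; _*_; _∸_; suc)
open import Data.Product using (_×_)
open import Data.Fin using (Fin)
open import Data.Fin.Subset using (⊤; _-_; ∁)

import Data.Nat as ℕ
open import Data.Nat using (z≤n; s≤s)
open import Data.Nat.Properties
  using (<⇒≢; ≤-reflexive; ≤-trans; ⊔-sel; m≤n⇒m≤n⊔o; m≤n⇒m≤o⊔n; +-mono-≤; suc-injective; *-comm;
         +-commutativeSemigroup; module ≤-Reasoning)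
open import Algebra.Properties.CommutativeSemigroup +-commutativeSemigroup using (interchange)
open import Data.Bool using (Bool; true; false; not; _∧_; _xor_; T)
import Data.Bool as Bool
open import Data.Bool.Properties using (xor-comm; xor-same; ¬-not; T-∧; T-≡)
open import Data.Bool.ListAction using (any)
open import Data.Empty using (⊥-elim)
import Data.Fin as Fin
open import Data.Fin using (zero; suc)
open import Data.Fin.Subset using (Subset; ⁅_⁆; _∪_; ∣_∣; inside; outside)
  renaming (_∈_ to _∈ˢ_; _∉_ to _∉ˢ_; _⊆_ to _⊆ˢ_; ⊥ to ∅)
open import Data.Fin.Subset.Properties
  using (_∈?_; _⊆?_; ∉⊥; ∈⊤; ⊆⊤; p─⊥≡p; ∪-identityˡ; ∪-comm; x∈⁅x⁆; x∈⁅y⁆⇒x≡y; x∈p∪q⁺; x∈p∪q⁻;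
         x∈p⇒x∉∁p; x∈p∧x≢y⇒x∈p-y; p⊂q⇒∣p∣<∣q∣)
open import Data.List using (List; []; _∷_; [_]; map; _++_; filter; length; foldr; tabulate; allFin)
open import Data.List.Properties
  using (length-map; length-++; filter-notAll; foldr-preservesᵒ; map-tabulate; foldr-map)
open import Data.List.Membership.Propositional using (_∈_)
open import Data.List.Membership.Propositional.Properties
  using (∈-map⁺; ∈-map⁻; ∈-++⁺ˡ; ∈-++⁺ʳ; ∈-++⁻; ∈-filter⁺; ∈-filter⁻; foldr-selective)
import Data.List.Relation.Unary.All as All
import Data.List.Relation.Unary.All.Properties as All
open import Data.List.Relation.Unary.AllPairs using ([]; _∷_)
import Data.List.Relation.Unary.Any as Any
open import Data.List.Relation.Unary.Any using (here; there; satisfied)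
open import Data.List.Relation.Unary.Any.Properties using (any⁻)
open import Data.List.Relation.Unary.Unique.Propositional using (Unique)
import Data.List.Relation.Unary.Unique.Propositional.Properties as Unique
open import Data.List.Relation.Binary.Subset.Propositional using (_⊆_)
open import Data.List.Relation.Binary.Sublist.Propositional using ([]; _∷_; _∷ʳ_) renaming (_⊆_ to _⊑_)
open import Data.List.Relation.Binary.Sublist.Propositional.Properties using (All-resp-⊆; Any-resp-⊆)
open import Data.Product using (Σ; ∃; ∃₂; _,_; proj₁; proj₂)
open import Data.Sum using (_⊎_; inj₁; inj₂)
import Data.Sum as Sum
open import Data.Vec using ([]; _∷_; lookup; _[_]≔_; here; there)
open import Data.Vec.Properties
  using (zipWith-comm; ∷-injectiveʳ; lookup∘tabulate; []=⇒lookup; lookup⇒[]=; []≔-lookup)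
open import Function using (_∘_)
open import Function.Bundles using (Equivalence)
open import Relation.Binary.Definitions using (DecidableEquality)
open import Relation.Binary.PropositionalEquality as ≡
  using (_≡_; refl; trans; cong; cong₂; subst; module ≡-Reasoning)
open import Relation.Nullary using (¬_; Dec; does; yes; no; ¬?; contradiction)
open import Relation.Nullary.Decidable using (⌊_⌋; toWitness; _×-dec_)
open import Relation.Unary using (Pred; Decidable)

private
  variable
    n : ℕ
    u v w x : Fin n
    A B X Y : Subset n

module _ {ℓ} {E : Set ℓ} where

  Unique-resp-⊇ : {xs ys : List E} → xs ⊑ ys → Unique ys → Unique xs
  Unique-resp-⊇ []         []       = []
  Unique-resp-⊇ (_ ∷ʳ p)   (_ ∷ u)  = Unique-resp-⊇ p u
  Unique-resp-⊇ (refl ∷ p) (y∉ ∷ u) = All-resp-⊆ p y∉ ∷ Unique-resp-⊇ p u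

  Unique-map⁺-local : ∀ {ℓ′} {F : Set ℓ′} {f : E → F} {xs} →
                      (∀ {x y} → x ∈ xs → y ∈ xs → f x ≡ f y → x ≡ y) →
                      Unique xs → Unique (map f xs)
  Unique-map⁺-local inj []       = []
  Unique-map⁺-local inj (x∉ ∷ u) =
    All.map⁺ (All.tabulate λ y∈ fx≡fy → All.lookup x∉ y∈ (inj (here refl) (there y∈) fx≡fy))
    ∷ Unique-map⁺-local (λ p q → inj (there p) (there q)) u

  Unique⇒length≤ : DecidableEquality E → {xs ys : List E} → Unique xs → xs ⊆ ys → length xs ≤ length ys
  Unique⇒length≤ _≟_ []                       _     = z≤n
  Unique⇒length≤ _≟_ {x ∷ xs} {ys} (x∉ ∷ u) xs⊆ys =
    ≤-trans (s≤s (Unique⇒length≤ _≟_ u xs⊆ys-x)) (filter-notAll (¬? ∘ (_≟ x)) ys x∈ys)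
    where
    xs⊆ys-x : xs ⊆ filter (¬? ∘ (_≟ x)) ys
    xs⊆ys-x y∈xs = ∈-filter⁺ (¬? ∘ (_≟ x)) (xs⊆ys (there y∈xs)) (λ y≡x → All.lookup x∉ y∈xs (≡.sym y≡x))
    x∈ys = Any.map (λ x≡y y≢x → y≢x (≡.sym x≡y)) (xs⊆ys (here refl))

  ∈-sublists⇒⊑ : {xs ys : List E} → xs ∈ sublists ys → xs ⊑ ys
  ∈-sublists⇒⊑ {ys = []}     (here refl) = []
  ∈-sublists⇒⊑ {ys = y ∷ ys} xs∈ with ∈-++⁻ (sublists ys) xs∈
  ... | inj₁ xs∈′ = y ∷ʳ ∈-sublists⇒⊑ xs∈′
  ... | inj₂ xs∈′ with _ , xs′∈ , refl ← ∈-map⁻ (y ∷_) xs∈′ = refl ∷ ∈-sublists⇒⊑ xs′∈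

  filter∈sublists : ∀ {p} {P : Pred E p} (P? : Decidable P) xs → filter P? xs ∈ sublists xs
  filter∈sublists P? []       = here refl
  filter∈sublists P? (x ∷ xs) with does (P? x)
  ... | true  = ∈-++⁺ʳ (sublists xs) (∈-map⁺ (x ∷_) (filter∈sublists P? xs))
  ... | false = ∈-++⁺ˡ (filter∈sublists P? xs)

∈⇒≤maximum : ∀ {m ms} → m ∈ ms → m ≤ maximum ms
∈⇒≤maximum {ms = ms} m∈ms =
  foldr-preservesᵒ (λ a b → Sum.[ m≤n⇒m≤n⊔o b , m≤n⇒m≤o⊔n a ]) 0 ms (inj₂ (Any.map ≤-reflexive m∈ms))

Δ-comm : (X Y : Subset n) → X Δ Y ≡ Y Δ X
Δ-comm = zipWith-comm xor-comm

Δ-self : (X : Subset n) → X Δ X ≡ ∅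
Δ-self []      = refl
Δ-self (x ∷ X) = cong₂ _∷_ (xor-same x) (Δ-self X)

Δ≡∅⇒≡ : X Δ Y ≡ ∅ → X ≡ Y
Δ≡∅⇒≡ {X = []}    {[]}    _  = refl
Δ≡∅⇒≡ {X = x ∷ X} {y ∷ Y} eq with x | y | eq
... | false | false | eq′ = cong (false ∷_) (Δ≡∅⇒≡ (∷-injectiveʳ eq′))
... | true  | true  | eq′ = cong (true ∷_) (Δ≡∅⇒≡ (∷-injectiveʳ eq′))
... | false | true  | ()
... | true  | false | ()

∈Δ⁺ : x ∈ˢ X → x ∉ˢ Y → x ∈ˢ X Δ Y
∈Δ⁺ {Y = outside ∷ Y} here      _   = here
∈Δ⁺ {Y = inside  ∷ Y} here      x∉Y = contradiction here x∉Y
∈Δ⁺ {Y = _       ∷ Y} (there p) x∉Y = there (∈Δ⁺ p (x∉Y ∘ there))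

∉Δ : x ∈ˢ X → x ∈ˢ Y → x ∉ˢ X Δ Y
∉Δ here      here      ()
∉Δ (there p) (there q) (there r) = ∉Δ p q r

Δ-[]≔ : (v : Fin n) {b : Bool} → lookup X v ≡ lookup Y v → (X [ v ]≔ b) Δ (Y [ v ]≔ b) ≡ X Δ Y
Δ-[]≔ {X = x ∷ X} {y ∷ Y} zero {b} refl = cong (_∷ X Δ Y) (trans (xor-same b) (≡.sym (xor-same x)))
Δ-[]≔ {X = x ∷ X} {y ∷ Y} (suc v) eq    = cong ((x xor y) ∷_) (Δ-[]≔ v eq)

∣[]≔inside∣ : (X : Subset n) (v : Fin n) → ∣ X [ v ]≔ inside ∣ ≡ suc ∣ X [ v ]≔ outside ∣
∣[]≔inside∣ (x       ∷ X) zero    = refl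
∣[]≔inside∣ (inside  ∷ X) (suc v) = cong suc (∣[]≔inside∣ X v)
∣[]≔inside∣ (outside ∷ X) (suc v) = ∣[]≔inside∣ X v

-≡[]≔outside : (X : Subset n) (v : Fin n) → X - v ≡ X [ v ]≔ outside
-≡[]≔outside (x ∷ X) zero    = cong (outside ∷_) (p─⊥≡p X)
-≡[]≔outside (x ∷ X) (suc v) = cong (x ∷_) (-≡[]≔outside X v)

⁅⁆∪≡[]≔inside : (X : Subset n) (v : Fin n) → ⁅ v ⁆ ∪ X ≡ X [ v ]≔ inside
⁅⁆∪≡[]≔inside (x ∷ X) zero    = cong (inside ∷_) (∪-identityˡ X)
⁅⁆∪≡[]≔inside (x ∷ X) (suc v) = cong (x ∷_) (⁅⁆∪≡[]≔inside X v)

∉⇒lookup≡outside : x ∉ˢ X → lookup X x ≡ outside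
∉⇒lookup≡outside {x = x} {X} x∉X = ¬-not (x∉X ∘ lookup⇒[]= x X)

module _ {X : Subset n} {v : Fin n} where
  open ≡-Reasoning

  ∣X∣≡1+∣X-v∣ : v ∈ˢ X → ∣ X ∣ ≡ suc ∣ X - v ∣
  ∣X∣≡1+∣X-v∣ v∈X = begin
    ∣ X ∣                     ≡⟨ cong ∣_∣ ([]≔-lookup X v) ⟨
    ∣ X [ v ]≔ lookup X v ∣   ≡⟨ cong (λ b → ∣ X [ v ]≔ b ∣) ([]=⇒lookup v∈X) ⟩
    ∣ X [ v ]≔ inside ∣       ≡⟨ ∣[]≔inside∣ X v ⟩
    suc ∣ X [ v ]≔ outside ∣  ≡⟨ cong (suc ∘ ∣_∣) (-≡[]≔outside X v) ⟨
    suc ∣ X - v ∣             ∎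

  ∣⁅v⁆∪X∣≡1+∣X∣ : v ∉ˢ X → ∣ ⁅ v ⁆ ∪ X ∣ ≡ suc ∣ X ∣
  ∣⁅v⁆∪X∣≡1+∣X∣ v∉X = begin
    ∣ ⁅ v ⁆ ∪ X ∣                ≡⟨ cong ∣_∣ (⁅⁆∪≡[]≔inside X v) ⟩
    ∣ X [ v ]≔ inside ∣          ≡⟨ ∣[]≔inside∣ X v ⟩
    suc ∣ X [ v ]≔ outside ∣     ≡⟨ cong (λ b → suc ∣ X [ v ]≔ b ∣) (∉⇒lookup≡outside v∉X) ⟨
    suc ∣ X [ v ]≔ lookup X v ∣  ≡⟨ cong (suc ∘ ∣_∣) ([]≔-lookup X v) ⟩
    suc ∣ X ∣                    ∎

module _ {X Y : Subset n} {v : Fin n} where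
  open ≡-Reasoning

  [X-v]Δ[Y-v]≡XΔY : v ∈ˢ X → v ∈ˢ Y → (X - v) Δ (Y - v) ≡ X Δ Y
  [X-v]Δ[Y-v]≡XΔY v∈X v∈Y = begin
    (X - v) Δ (Y - v)                         ≡⟨ cong₂ _Δ_ (-≡[]≔outside X v) (-≡[]≔outside Y v) ⟩
    (X [ v ]≔ outside) Δ (Y [ v ]≔ outside)   ≡⟨ Δ-[]≔ v (trans ([]=⇒lookup v∈X) (≡.sym ([]=⇒lookup v∈Y))) ⟩
    X Δ Y                                     ∎

  [v∪X]Δ[v∪Y]≡XΔY : v ∉ˢ X → v ∉ˢ Y → (⁅ v ⁆ ∪ X) Δ (⁅ v ⁆ ∪ Y) ≡ X Δ Y
  [v∪X]Δ[v∪Y]≡XΔY v∉X v∉Y = begin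
    (⁅ v ⁆ ∪ X) Δ (⁅ v ⁆ ∪ Y)               ≡⟨ cong₂ _Δ_ (⁅⁆∪≡[]≔inside X v) (⁅⁆∪≡[]≔inside Y v) ⟩
    (X [ v ]≔ inside) Δ (Y [ v ]≔ inside)   ≡⟨ Δ-[]≔ v (trans (∉⇒lookup≡outside v∉X) (≡.sym (∉⇒lookup≡outside v∉Y))) ⟩
    X Δ Y                                   ∎

v∉X-v : (X : Subset n) (v : Fin n) → v ∉ˢ X - v
v∉X-v (x ∷ X) zero    ()
v∉X-v (x ∷ X) (suc v) (there v∈) = v∉X-v X v v∈

X-v⊆⊤-v : (X : Subset n) (v : Fin n) → X - v ⊆ˢ ⊤ - v
X-v⊆⊤-v X v x∈ = x∈p∧x≢y⇒x∈p-y ∈⊤ λ { refl → v∉X-v X v x∈ }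

x∈⁅x⁆∪X : (x : Fin n) → x ∈ˢ ⁅ x ⁆ ∪ X
x∈⁅x⁆∪X x = x∈p∪q⁺ (inj₁ (x∈⁅x⁆ x))

∈⁅u⁆∪⁅w⁆⇒ : x ∈ˢ ⁅ u ⁆ ∪ ⁅ w ⁆ → x ≡ u ⊎ x ≡ w
∈⁅u⁆∪⁅w⁆⇒ {u = u} {w} x∈ = Sum.map (x∈⁅y⁆⇒x≡y u) (x∈⁅y⁆⇒x≡y w) (x∈p∪q⁻ ⁅ u ⁆ ⁅ w ⁆ x∈)

-- If w ∉ Y then Y ⊂ X, contradicting ∣ X ∣ ≡ ∣ Y ∣.
token-moves : ∣ X ∣ ≡ ∣ Y ∣ → X Δ Y ≡ ⁅ u ⁆ ∪ ⁅ w ⁆ → u ∈ˢ X → w ∈ˢ Y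
token-moves {X = X} {Y} {u} {w} ∣X∣≡∣Y∣ XΔY≡uw u∈X with w ∈? Y
... | yes w∈Y = w∈Y
... | no  w∉Y = ⊥-elim (<⇒≢ (p⊂q⇒∣p∣<∣q∣ (Y⊆X , u , u∈X , u∉Y)) (≡.sym ∣X∣≡∣Y∣))
  where
  u∉Y : u ∉ˢ Y
  u∉Y u∈Y = ∉Δ u∈X u∈Y (subst (u ∈ˢ_) (≡.sym XΔY≡uw) (x∈⁅x⁆∪X u))
  Y⊆X : Y ⊆ˢ X
  Y⊆X {x} x∈Y with x ∈? X
  ... | yes x∈X = x∈X
  ... | no  x∉X with ∈⁅u⁆∪⁅w⁆⇒ (subst (x ∈ˢ_) (trans (Δ-comm Y X) XΔY≡uw) (∈Δ⁺ x∈Y x∉X))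
  ...   | inj₁ refl = contradiction u∈X x∉X
  ...   | inj₂ refl = contradiction x∈Y w∉Y

¬T⇒T-not : ∀ {b} → ¬ T b → T (not b)
¬T⇒T-not {false} _  = _
¬T⇒T-not {true}  ¬b = ¬b _

module _ (G : Graph n) where

  -- tokenAdj G A B unfolds to isEdgeSet (A Δ B).
  isEdgeSet : Subset n → Bool
  isEdgeSet D = any (λ u → any (λ w → adj G u w ∧ ⌊ D ≟ˢ (⁅ u ⁆ ∪ ⁅ w ⁆) ⌋) (allFin n)) (allFin n)

  isEdgeSet⇒ : ∀ {D} → T (isEdgeSet D) → ∃₂ λ u w → T (adj G u w) × D ≡ ⁅ u ⁆ ∪ ⁅ w ⁆
  isEdgeSet⇒ t =
    let u , t′     = satisfied (any⁻ _ (allFin n) t)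
        w , t″     = satisfied (any⁻ _ (allFin n) t′)
        uw , D≡uw  = Equivalence.to T-∧ t″
    in u , w , uw , toWitness D≡uw

  tokenAdj-cong : A Δ B ≡ X Δ Y → tokenAdj G A B ≡ tokenAdj G X Y
  tokenAdj-cong = cong isEdgeSet

  tokenAdj-sym : (A B : Subset n) → tokenAdj G A B ≡ tokenAdj G B A
  tokenAdj-sym A B = tokenAdj-cong (Δ-comm A B)

  tokenAdj-irrefl : (A : Subset n) → T (not (tokenAdj G A A))
  tokenAdj-irrefl A = ¬T⇒T-not λ t →
    let u , w , _ , ∅≡uw = isEdgeSet⇒ (subst T (cong isEdgeSet (Δ-self A)) t)
    in ∉⊥ (subst (u ∈ˢ_) (≡.sym ∅≡uw) (x∈⁅x⁆∪X u))

  token-slides-to-neighbour : ∣ X ∣ ≡ ∣ Y ∣ → T (tokenAdj G X Y) → v ∈ˢ X → v ∉ˢ Y →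
                              ∃ λ w → T (adj G v w) × w ∈ˢ Y
  token-slides-to-neighbour {v = v} ∣X∣≡∣Y∣ t v∈X v∉Y
    with u , w , uw , XΔY≡uw ← isEdgeSet⇒ t
    with ∈⁅u⁆∪⁅w⁆⇒ (subst (v ∈ˢ_) XΔY≡uw (∈Δ⁺ v∈X v∉Y))
  ... | inj₁ refl = w , uw , token-moves ∣X∣≡∣Y∣ XΔY≡uw v∈X
  ... | inj₂ refl = u , subst T (Graph.sym G u v) uw ,
                    token-moves ∣X∣≡∣Y∣ (trans XΔY≡uw (∪-comm ⁅ u ⁆ ⁅ v ⁆)) v∈X

  v∈N[v] : v ∈ˢ closedNbhd G v
  v∈N[v] {v = v} = x∈⁅x⁆∪X v

  adj⇒∈N[v] : T (adj G v w) → w ∈ˢ closedNbhd G v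
  adj⇒∈N[v] {v = v} {w} vw =
    x∈p∪q⁺ (inj₂ (lookup⇒[]= w _ (trans (lookup∘tabulate (adj G v) w) (Equivalence.to T-≡ vw))))

  Independent : List (Subset n) → Set
  Independent L = ∀ {A B} → A ∈ L → B ∈ L → T (not (tokenAdj G A B))

  independent⇒Independent : ∀ L → T (independent G L) → Independent L
  independent⇒Independent (A ∷ L) t (here refl) (here refl) = tokenAdj-irrefl A
  independent⇒Independent (A ∷ L) t (here refl) (there B∈L) =
    All.lookup (All.all⁺ _ L (proj₁ (Equivalence.to T-∧ t))) B∈L
  independent⇒Independent (A ∷ L) t {B} (there B∈L) (here refl) =
    subst (T ∘ not) (tokenAdj-sym A B) (All.lookup (All.all⁺ _ L (proj₁ (Equivalence.to T-∧ t))) B∈L)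
  independent⇒Independent (A ∷ L) t (there A∈L) (there B∈L) =
    independent⇒Independent L (proj₂ (Equivalence.to T-∧ t)) A∈L B∈L

  Independent⇒independent : ∀ L → Independent L → T (independent G L)
  Independent⇒independent []      _   = _
  Independent⇒independent (A ∷ L) ind = Equivalence.from T-∧
    (All.all⁻ _ (All.tabulate (ind (here refl) ∘ there)) , Independent⇒independent L (λ a b → ind (there a) (there b)))

  Independent-++ : {L M : List (Subset n)} → Independent L → Independent M →
                   (∀ {A B} → A ∈ L → B ∈ M → T (not (tokenAdj G A B))) → Independent (L ++ M)
  Independent-++ {L} indL indM cross A∈ B∈ with ∈-++⁻ L A∈ | ∈-++⁻ L B∈
  ... | inj₁ a | inj₁ b = indL a b
  ... | inj₁ a | inj₂ b = cross a b
  ... | inj₂ a | inj₁ b = subst (T ∘ not) (tokenAdj-sym _ _) (cross b a)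
  ... | inj₂ a | inj₂ b = indM a b

module _ {f : Subset n → Subset n} {W : List (Subset n)}
         (f-Δ : ∀ {A B} → A ∈ W → B ∈ W → f A Δ f B ≡ A Δ B) where

  Δ-preserving⇒Unique : Unique W → Unique (map f W)
  Δ-preserving⇒Unique = Unique-map⁺-local λ {A} {B} A∈ B∈ fA≡fB → Δ≡∅⇒≡ (begin
    A Δ B      ≡⟨ f-Δ A∈ B∈ ⟨
    f A Δ f B  ≡⟨ cong (f A Δ_) fA≡fB ⟨
    f A Δ f A  ≡⟨ Δ-self (f A) ⟩
    ∅          ∎)
    where open ≡-Reasoning

  Δ-preserving⇒Independent : (G : Graph n) → Independent G W → Independent G (map f W)
  Δ-preserving⇒Independent G ind A′∈ B′∈
    with A , A∈ , refl ← ∈-map⁻ f A′∈ | B , B∈ , refl ← ∈-map⁻ f B′∈ =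
    subst (T ∘ not) (tokenAdj-cong G (≡.sym (f-Δ A∈ B∈))) (ind A∈ B∈)

∈-allSubsets : (A : Subset n) → A ∈ allSubsets n
∈-allSubsets []            = here refl
∈-allSubsets (outside ∷ A) = ∈-++⁺ˡ (∈-map⁺ (outside ∷_) (∈-allSubsets A))
∈-allSubsets (inside  ∷ A) = ∈-++⁺ʳ (map (outside ∷_) (allSubsets _)) (∈-map⁺ (inside ∷_) (∈-allSubsets A))

allSubsets-Unique : ∀ n → Unique (allSubsets n)
allSubsets-Unique ℕ.zero    = All.[] ∷ []
allSubsets-Unique (ℕ.suc n) =
  Unique.++⁺ (Unique.map⁺ ∷-injectiveʳ (allSubsets-Unique n)) (Unique.map⁺ ∷-injectiveʳ (allSubsets-Unique n)) disjoint
  where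
  disjoint : ∀ {A} → ¬ (A ∈ map (outside ∷_) (allSubsets n) × A ∈ map (inside ∷_) (allSubsets n))
  disjoint (p , q) with _ , _ , refl ← ∈-map⁻ (outside ∷_) p | _ , _ , () ← ∈-map⁻ (inside ∷_) q

record IndependentSet (G : Graph n) (S : Subset n) (k : ℕ) : Set where
  field
    members       : List (Subset n)
    distinct      : Unique members
    within        : ∀ {A} → A ∈ members → A ⊆ˢ S
    sized         : ∀ {A} → A ∈ members → ∣ A ∣ ≡ k
    isIndependent : Independent G members

open IndependentSet

module _ (G : Graph n) (S : Subset n) (k : ℕ) where

  private
    isTokenVertex? : (A : Subset n) → Dec (A ⊆ˢ S × ∣ A ∣ ≡ k)
    isTokenVertex? A = (A ⊆? S) ×-dec (∣ A ∣ ℕ.≟ k)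

    independent? : (L : List (Subset n)) → Dec (independent G L ≡ true)
    independent? L = independent G L Bool.≟ true

  ∈-tokenVertices⁺ : A ⊆ˢ S → ∣ A ∣ ≡ k → A ∈ tokenVertices S k
  ∈-tokenVertices⁺ {A = A} A⊆S ∣A∣≡k = ∈-filter⁺ isTokenVertex? (∈-allSubsets A) (A⊆S , ∣A∣≡k)

  ∈-tokenVertices⁻ : A ∈ tokenVertices S k → A ⊆ˢ S × ∣ A ∣ ≡ k
  ∈-tokenVertices⁻ A∈ = proj₂ (∈-filter⁻ isTokenVertex? {xs = allSubsets n} A∈)

  -- βF only ranges over order-preserving sublists of tokenVertices, so I is re-listed in that order.
  size≤βF : (I : IndependentSet G S k) → length (members I) ≤ βF G S k
  size≤βF I = ≤-trans
    (Unique⇒length≤ _≟ˢ_ (distinct I) (λ A∈ → ∈-filter⁺ _∈I? (∈-tokenVertices⁺ (within I A∈) (sized I A∈)) A∈))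
    (∈⇒≤maximum (∈-map⁺ length (∈-filter⁺ independent? (filter∈sublists _∈I? (tokenVertices S k))
      (Equivalence.to T-≡ (Independent⇒independent G I′ λ p q → isIndependent I (∈I p) (∈I q))))))
    where
    _∈I? : (A : Subset n) → Dec (A ∈ members I)
    A ∈I? = Any.any? (A ≟ˢ_) (members I)
    I′ = filter _∈I? (tokenVertices S k)
    ∈I : ∀ {A} → A ∈ I′ → A ∈ members I
    ∈I = proj₂ ∘ ∈-filter⁻ _∈I? {xs = tokenVertices S k}

  βF-attained : Σ (IndependentSet G S k) λ I → length (members I) ≡ βF G S k
  βF-attained with foldr-selective ⊔-sel 0 (map length (filter independent? (sublists (tokenVertices S k))))
  ... | inj₁ βF≡0 = record { members = [] ; distinct = [] ; within = λ () ; sized = λ () ; isIndependent = λ () }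
                  , ≡.sym βF≡0
  ... | inj₂ βF∈ with W , W∈ , βF≡∣W∣ ← ∈-map⁻ length βF∈
                 with W∈sublists , W-indep ← ∈-filter⁻ independent? {xs = sublists (tokenVertices S k)} W∈ =
    record { members       = W
           ; distinct      = Unique-resp-⊇ W⊑ (Unique.filter⁺ isTokenVertex? (allSubsets-Unique n))
           ; within        = proj₁ ∘ ∈-tokenVertices⁻ ∘ Any-resp-⊆ W⊑
           ; sized         = proj₂ ∘ ∈-tokenVertices⁻ ∘ Any-resp-⊆ W⊑
           ; isIndependent = independent⇒Independent G W (Equivalence.from T-≡ W-indep)
           }
    , ≡.sym βF≡∣W∣
    where W⊑ = ∈-sublists⇒⊑ W∈sublists

module _ where
  open ≡-Reasoning

  sumV-suc : (f : Fin (suc n) → ℕ) → sumV f ≡ f zero + sumV (f ∘ suc)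
  sumV-suc {n} f = cong (f zero +_) (begin
    foldr (λ v acc → f v + acc) 0 (tabulate Fin.suc)        ≡⟨ cong (foldr _ 0) (map-tabulate {n = n} (λ v → v) Fin.suc) ⟨
    foldr (λ v acc → f v + acc) 0 (map Fin.suc (allFin n))  ≡⟨ foldr-map _ Fin.suc 0 (allFin n) ⟩
    sumV (f ∘ suc)                                          ∎)

  sumV-cong : {f g : Fin n → ℕ} → (∀ v → f v ≡ g v) → sumV f ≡ sumV g
  sumV-cong {ℕ.zero}  _ = refl
  sumV-cong {ℕ.suc n} {f} {g} f≡g = begin
    sumV f                   ≡⟨ sumV-suc f ⟩
    f zero + sumV (f ∘ suc)  ≡⟨ cong₂ _+_ (f≡g zero) (sumV-cong (f≡g ∘ suc)) ⟩
    g zero + sumV (g ∘ suc)  ≡⟨ sumV-suc g ⟨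
    sumV g                   ∎

  sumV-+ : (f g : Fin n → ℕ) → sumV (λ v → f v + g v) ≡ sumV f + sumV g
  sumV-+ {ℕ.zero}  f g = refl
  sumV-+ {ℕ.suc n} f g = begin
    sumV (λ v → f v + g v)                                  ≡⟨ sumV-suc (λ v → f v + g v) ⟩
    (f zero + g zero) + sumV (λ v → f (suc v) + g (suc v))  ≡⟨ cong ((f zero + g zero) +_) (sumV-+ (f ∘ suc) (g ∘ suc)) ⟩
    (f zero + g zero) + (sumV (f ∘ suc) + sumV (g ∘ suc))   ≡⟨ interchange (f zero) (g zero) _ _ ⟩
    (f zero + sumV (f ∘ suc)) + (g zero + sumV (g ∘ suc))   ≡⟨ cong₂ _+_ (sumV-suc f) (sumV-suc g) ⟨
    sumV f + sumV g                                         ∎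

  sumV-zero : sumV {n} (λ _ → 0) ≡ 0
  sumV-zero {ℕ.zero}  = refl
  sumV-zero {ℕ.suc n} = trans (sumV-suc {n} (λ _ → 0)) (sumV-zero {n})

sumV-mono : {f g : Fin n → ℕ} → (∀ v → f v ≤ g v) → sumV f ≤ sumV g
sumV-mono {ℕ.zero}  _ = z≤n
sumV-mono {ℕ.suc n} {f} {g} f≤g =
  ≡.subst₂ _≤_ (≡.sym (sumV-suc f)) (≡.sym (sumV-suc g)) (+-mono-≤ (f≤g zero) (sumV-mono (f≤g ∘ suc)))

count : Fin n → List (Subset n) → ℕ
count v W = length (filter (v ∈?_) W)

count-∷ : (v : Fin n) (A : Subset n) (W : List (Subset n)) → count v (A ∷ W) ≡ count v [ A ] + count v W
count-∷ v A W with does (v ∈? A)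
... | true  = refl
... | false = refl

count-suc : (v : Fin n) (a : Bool) (A : Subset n) → count (suc v) [ a ∷ A ] ≡ count v [ A ]
count-suc v a A with does (v ∈? A)
... | true  = refl
... | false = refl

sumV-count-[_] : (A : Subset n) → sumV (λ v → count v [ A ]) ≡ ∣ A ∣
sumV-count-[ [] ]          = refl
sumV-count-[ inside ∷ A ]  = trans (sumV-suc (λ v → count v [ inside ∷ A ]))
                                   (cong suc (trans (sumV-cong (λ v → count-suc v inside A)) sumV-count-[ A ]))
sumV-count-[ outside ∷ A ] = trans (sumV-suc (λ v → count v [ outside ∷ A ]))
                                   (trans (sumV-cong (λ v → count-suc v outside A)) sumV-count-[ A ])

sumV-count : (W : List (Subset n)) {k : ℕ} → (∀ {A} → A ∈ W → ∣ A ∣ ≡ k) → sumV (λ v → count v W) ≡ length W * k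
sumV-count {n} []      _         = sumV-zero {n}
sumV-count (A ∷ W) {k} ∣W∣≡k = begin
  sumV (λ v → count v (A ∷ W))                         ≡⟨ sumV-cong (λ v → count-∷ v A W) ⟩
  sumV (λ v → count v [ A ] + count v W)               ≡⟨ sumV-+ (λ v → count v [ A ]) (λ v → count v W) ⟩
  sumV (λ v → count v [ A ]) + sumV (λ v → count v W)  ≡⟨ cong₂ _+_ (trans sumV-count-[ A ] (∣W∣≡k (here refl)))
                                                                   (sumV-count W (∣W∣≡k ∘ there)) ⟩
  k + length W * k                                     ∎
  where open ≡-Reasoning

module _ (G : Graph n) {k : ℕ} where

  removeVertex : IndependentSet G ⊤ (suc k) → (v : Fin n) → IndependentSet G (⊤ - v) k
  removeVertex I v = record
    { members       = map (_- v) Wᵥ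
    ; distinct      = Δ-preserving⇒Unique Δ-pres (Unique.filter⁺ (v ∈?_) (distinct I))
    ; within        = λ A′∈ → let A , _ , A′≡A-v = ∈-map⁻ (_- v) A′∈ in
                        subst (_⊆ˢ ⊤ - v) (≡.sym A′≡A-v) (X-v⊆⊤-v A v)
    ; sized         = λ A′∈ → let A , A∈ , A′≡A-v = ∈-map⁻ (_- v) A′∈ in
                        trans (cong ∣_∣ A′≡A-v) (suc-injective (trans (≡.sym (∣X∣≡1+∣X-v∣ (v∈ A∈))) (sized I (∈I A∈))))
    ; isIndependent = Δ-preserving⇒Independent Δ-pres G λ A∈ B∈ → isIndependent I (∈I A∈) (∈I B∈)
    }
    where
    Wᵥ = filter (v ∈?_) (members I)
    ∈I : ∀ {A} → A ∈ Wᵥ → A ∈ members I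
    ∈I = proj₁ ∘ ∈-filter⁻ (v ∈?_) {xs = members I}
    v∈ : ∀ {A} → A ∈ Wᵥ → v ∈ˢ A
    v∈ = proj₂ ∘ ∈-filter⁻ (v ∈?_) {xs = members I}
    Δ-pres : ∀ {A B} → A ∈ Wᵥ → B ∈ Wᵥ → (A - v) Δ (B - v) ≡ A Δ B
    Δ-pres A∈ B∈ = [X-v]Δ[Y-v]≡XΔY (v∈ A∈) (v∈ B∈)

  addVertex : (v : Fin n) → IndependentSet G (⊤ - v) k → IndependentSet G (∁ (closedNbhd G v)) (suc k) →
              IndependentSet G ⊤ (suc k)
  addVertex v I J = record
    { members       = map (⁅ v ⁆ ∪_) (members I) ++ members J
    ; distinct      = Unique.++⁺ (Δ-preserving⇒Unique Δ-pres (distinct I)) (distinct J) disjoint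
    ; within        = λ _ → ⊆⊤
    ; sized         = λ A∈ → Sum.[ sized-v∪I , sized J ] (∈-++⁻ (map (⁅ v ⁆ ∪_) (members I)) A∈)
    ; isIndependent = Independent-++ G (Δ-preserving⇒Independent Δ-pres G (isIndependent I)) (isIndependent J) cross
    }
    where
    v∉I : ∀ {A} → A ∈ members I → v ∉ˢ A
    v∉I A∈ = v∉X-v ⊤ v ∘ within I A∈
    N[v]∉J : ∀ {B x} → B ∈ members J → x ∈ˢ closedNbhd G v → x ∉ˢ B
    N[v]∉J B∈ x∈N x∈B = x∈p⇒x∉∁p x∈N (within J B∈ x∈B)
    Δ-pres : ∀ {A B} → A ∈ members I → B ∈ members I → (⁅ v ⁆ ∪ A) Δ (⁅ v ⁆ ∪ B) ≡ A Δ B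
    Δ-pres A∈ B∈ = [v∪X]Δ[v∪Y]≡XΔY (v∉I A∈) (v∉I B∈)
    ∣v∪A∣≡1+k : ∀ {A} → A ∈ members I → ∣ ⁅ v ⁆ ∪ A ∣ ≡ suc k
    ∣v∪A∣≡1+k A∈ = trans (∣⁅v⁆∪X∣≡1+∣X∣ (v∉I A∈)) (cong suc (sized I A∈))
    sized-v∪I : ∀ {A′} → A′ ∈ map (⁅ v ⁆ ∪_) (members I) → ∣ A′ ∣ ≡ suc k
    sized-v∪I A′∈ with A , A∈ , refl ← ∈-map⁻ (⁅ v ⁆ ∪_) A′∈ = ∣v∪A∣≡1+k A∈
    disjoint : ∀ {X} → ¬ (X ∈ map (⁅ v ⁆ ∪_) (members I) × X ∈ members J)
    disjoint (X∈ , X∈J) with A , _ , refl ← ∈-map⁻ (⁅ v ⁆ ∪_) X∈ = N[v]∉J X∈J (v∈N[v] G) (x∈⁅x⁆∪X v)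
    cross : ∀ {A′ B} → A′ ∈ map (⁅ v ⁆ ∪_) (members I) → B ∈ members J → T (not (tokenAdj G A′ B))
    cross A′∈ B∈ with A , A∈ , refl ← ∈-map⁻ (⁅ v ⁆ ∪_) A′∈ = ¬T⇒T-not λ A′~B →
      let w , vw , w∈B = token-slides-to-neighbour G (trans (∣v∪A∣≡1+k A∈) (≡.sym (sized J B∈))) A′~B
                           (x∈⁅x⁆∪X v) (N[v]∉J B∈ (v∈N[v] G))
      in N[v]∉J B∈ (adj⇒∈N[v] G vw) w∈B

module _ (G : Graph n) (k : ℕ) where
  open ≤-Reasoning

  βF-lower-bound : (v : Fin n) → βF G (⊤ - v) k + βF G (∁ (closedNbhd G v)) (suc k) ≤ βF G ⊤ (suc k)
  βF-lower-bound v
    with I , ∣I∣≡β ← βF-attained G (⊤ - v) k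
       | J , ∣J∣≡β ← βF-attained G (∁ (closedNbhd G v)) (suc k) = begin
    βF G (⊤ - v) k + βF G (∁ (closedNbhd G v)) (suc k)         ≡⟨ cong₂ _+_ ∣I∣≡β ∣J∣≡β ⟨
    length (members I) + length (members J)                     ≡⟨ cong (_+ length (members J)) (length-map (⁅ v ⁆ ∪_) (members I)) ⟨
    length (map (⁅ v ⁆ ∪_) (members I)) + length (members J)   ≡⟨ length-++ (map (⁅ v ⁆ ∪_) (members I)) ⟨
    length (members (addVertex G v I J))                        ≤⟨ size≤βF G ⊤ (suc k) (addVertex G v I J) ⟩
    βF G ⊤ (suc k)                                              ∎

  βF-upper-bound : suc k * βF G ⊤ (suc k) ≤ sumV (λ v → βF G (⊤ - v) k)
  βF-upper-bound with W , ∣W∣≡β ← βF-attained G ⊤ (suc k) = begin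
    suc k * βF G ⊤ (suc k)            ≡⟨ cong (suc k *_) ∣W∣≡β ⟨
    suc k * length (members W)        ≡⟨ *-comm (suc k) (length (members W)) ⟩
    length (members W) * suc k        ≡⟨ sumV-count (members W) (sized W) ⟨
    sumV (λ v → count v (members W))  ≤⟨ sumV-mono count≤βF ⟩
    sumV (λ v → βF G (⊤ - v) k)       ∎
    where
    count≤βF : ∀ v → count v (members W) ≤ βF G (⊤ - v) k
    count≤βF v = subst (_≤ βF G (⊤ - v) k) (length-map (_- v) (filter (v ∈?_) (members W)))
                       (size≤βF G (⊤ - v) k (removeVertex G W v))

-- Both bounds hold for every k ≥ 1.
lemma5p1 : (n : ℕ) (G : Graph n) (k : ℕ) → 2 ≤ k → suc k ≤ n →
    ((v : Fin n) → βF G (⊤ - v) (k ∸ 1) + βF G (∁ (closedNbhd G v)) k ≤ βF G ⊤ k)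
    × (k * βF G ⊤ k ≤ sumV (λ v → βF G (⊤ - v) (k ∸ 1)))
lemma5p1 n G (suc k) _ _ = βF-lower-bound G k , βF-upper-bound G k
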